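{- Let $n\geq\ell\geq2$ be integers, fix a labeling of the rooted binary tree $T_n$ with root $x_0$, and let $G\subseteq M_{\ell,n}$ be a subgroup. Suppose that the group obtained by restricting the elements of $G$ to the subtree $T_{n-1}$ is all of $M_{\ell,n-1}$, and suppose there exists $\sigma_n\in G$ that acts trivially on $T_{n-1}$ and is an $(\ell,n)$-odd cousins map above $x_0$. Then $G=M_{\ell,n}$.
   Context: $T_\infty$ is the infinite rooted binary tree with root $x_0$, and $T_n$ its subtree of levels $0,\dots,n$. A labeling assigns to each node at level $m$ a word in $\{0,1\}^m$, bijectively per level, with children of $w$ labeled $w0,w1$. For a tree automorphism $\sigma$, node $y$, $m\geq1$: $\sigma$ sends the node $ys_1\dots s_m$ to $\sigma(y)t_1\dots t_m$, and $\operatorname{sgn}_m(\sigma,y)\in\{\pm1\}$ is the sign of the permutation $(s_1,\dots,s_m)\mapsto(t_1,\dots,t_m)$ of $\{0,1\}^m$. $M_\ell$ is the set of $\sigma\in\operatorname{Aut}(T_\infty)$ with $\operatorname{sgn}_\ell(\sigma,y)=+1$ for every node $y$, and $M_{\ell,n}$ is the group of restrictions of elements of $M_\ell$ to $T_n$. For $\sigma\in M_{\ell,n}$ and a node $w$ with children $y_0,y_1$ (where $\operatorname{sgn}_{\ell-1}(\sigma,y_0)=\operatorname{sgn}_{\ell-1}(\sigma,y_1)$ automatically), $\sigma$ acts $\ell$-negatively above $w$ if $\operatorname{sgn}_{\ell-1}(\sigma,y_0)=\operatorname{sgn}_{\ell-1}(\sigma,y_1)=-1$. For $n\geq\ell$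 and a node $x$, $\sigma$ is an $(\ell,n)$-odd cousins map above $x$ if the number of nodes $w$ lying $n-\ell$ levels above $x$ such that $\sigma$ acts $\ell$-negatively above $w$ is odd; otherwise it is an $(\ell,n)$-even cousins map above $x$. -}

module Defs where

open import Data.Nat using (ℕ; zero; suc; _+_; _≤_; _∸_)
open import Data.Bool using (Bool; true; false; _∧_; _∨_; not; if_then_else_)
open import Data.List using (List; []; _∷_; concatMap; map)
open import Data.Nat.ListAction using (sum)
open import Data.Product using (Σ; _×_; _,_)
open import Data.Unit using (⊤)
open import Relation.Binary.PropositionalEquality using (_≡_)
open import Function.Definitions using (Bijective)

-- Nodes of the binary tree, identified with their labels.
-- A node at level m carries a word in {0,1}^m (false = 0, true = 1).
-- Words are built by appending letters on the right ("snoc"), so that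
-- the children of w are  w ▸ false  (= w0)  and  w ▸ true  (= w1).

data Word : ℕ → Set where
  ε   : Word 0
  _▸_ : ∀ {m} → Word m → Bool → Word (suc m)

infixl 6 _▸_

parent : ∀ {m} → Word (suc m) → Word m
parent (w ▸ _) = w

_⊕_ : ∀ {k m} → Word k → Word m → Word (m + k)
y ⊕ ε       = y
y ⊕ (s ▸ b) = (y ⊕ s) ▸ b

suffix : ∀ m {k} → Word (m + k) → Word m
suffix zero    _       = ε
suffix (suc m) (w ▸ b) = suffix m w ▸ b

Map : Set
Map = ∀ {m} → Word m → Word m

idMap : Map
idMap w = w

_∘M_ : Map → Map → Map
(σ ∘M τ) w = σ (τ w)

record IsAutOn (P : ℕ → Set) (f : Map) : Set where
  field
    parentPres : ∀ {m} (w : Word m) (b : Bool) → P (suc m) →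
                 parent (f (w ▸ b)) ≡ f w
    bijective  : ∀ {m} → P m → Bijective {A = Word m} _≡_ _≡_ f

IsAutInf : Map → Set
IsAutInf = IsAutOn (λ _ → ⊤)

_≈[_]_ : Map → ℕ → Map → Set
σ ≈[ n ] τ = ∀ {m} → m ≤ n → (w : Word m) → σ w ≡ τ w

allWords : ∀ m → List (Word m)
allWords zero    = ε ∷ []
allWords (suc m) = concatMap (λ w → (w ▸ false) ∷ (w ▸ true) ∷ []) (allWords m)

eqW : ∀ {m} → Word m → Word m → Bool
eqW ε ε = true
eqW (u ▸ a) (v ▸ b) = eqW u v ∧ (if a then b else not b)

ltW : ∀ {m} → Word m → Word m → Bool
ltW ε ε = false
ltW (u ▸ a) (v ▸ b) = ltW u v ∨ (eqW u v ∧ (not a ∧ b))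

inversions : ∀ {m} → (Word m → Word m) → ℕ
inversions {m} p =
  sum (concatMap (λ u → map (λ v → if ltW u v ∧ ltW (p v) (p u) then 1 else 0)
                            (allWords m))
                 (allWords m))

isEven : ℕ → Bool
isEven zero          = true
isEven (suc zero)    = false
isEven (suc (suc n)) = isEven n

data Sign : Set where
  plus minus : Sign

sign : ∀ {m} → (Word m → Word m) → Sign
sign p = if isEven (inversions p) then plus else minus

-- sgn_m(σ, y): sign of  s ↦ t  where σ(y s) = σ(y) t
sgn : ∀ m → Map → ∀ {k} → Word k → Sign
sgn m σ y = sign (λ s → suffix m (σ (y ⊕ s)))

InMℓ : ℕ → Map → Set
InMℓ ℓ τ = IsAutInf τ × (∀ {k} (y : Word k) → sgn ℓ τ y ≡ plus)

-- σ (viewed on T_n) lies in M_{ℓ,n}: it is the restriction of some τ ∈ M_ℓ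
InMℓn : ℕ → ℕ → Map → Set
InMℓn ℓ n σ = Σ Map (λ τ → InMℓ ℓ τ × (τ ≈[ n ] σ))

isMinus : Sign → Bool
isMinus plus  = false
isMinus minus = true

negAboveB : ℕ → Map → ∀ {k} → Word k → Bool
negAboveB ℓ σ w = isMinus (sgn (ℓ ∸ 1) σ (w ▸ false)) ∧ isMinus (sgn (ℓ ∸ 1) σ (w ▸ true))

count : ∀ {A : Set} → (A → Bool) → List A → ℕ
count P []       = 0
count P (x ∷ xs) = (if P x then 1 else 0) + count P xs

OddCousins : ℕ → ℕ → Map → ∀ {k} → Word k → Set
OddCousins ℓ n σ x =
  isEven (count (λ s → negAboveB ℓ σ (x ⊕ s)) (allWords (n ∸ ℓ))) ≡ false

-- Write ℓ = d + 2, n = d + e + 2, N = n - 1, and view level N as the F₂-space of words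
-- of length N. An element of G fixing T_N is determined by its leaf pattern F (the
-- nodes of level N whose children it swaps), and it lies in M_{ℓ,n} iff F has even
-- parity on the block of level-N descendants of every node of level e. The realised
-- patterns form a subspace, stable under precomposition with the involutions of
-- M_{ℓ,N} (conjugate by their lifts to G): all translations and, for ℓ ≥ 3, the
-- transvections adding the letter at position j to the one at j + 1. If c has odd
-- total parity and c + c(· + u) is realised, convolving it with c gives δ₀ + δᵤ, as the
-- autocorrelation of c is δ₀. Since σ_n is an odd cousins map, this produces the pairs
-- δ₀ + δ(e_i) for i = e and i = e + 1, transvections carry them to every position
-- e ≤ i < N, and their translates span all patterns with even block parities. Finally
-- σ ∈ M_{ℓ,n} agrees on T_N with some g ∈ G and differs from it by such a pattern.

module Submission where

open import Defs
open import Algebra.Bundles using (CommutativeRing)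
open import Data.Bool using (Bool; true; false; _∧_; _∨_; not; if_then_else_; _xor_)
open import Data.Bool.Properties
  using (T-≡; ¬-not; xor-same; xor-comm; xor-assoc; xor-identityʳ; ∧-zeroʳ; ∧-identityʳ; ∧-comm;
         ∧-idem; ∧-distribˡ-xor; not-distribˡ-xor; not-involutive; xor-∧-commutativeRing)
open import Data.Nat using (ℕ; zero; suc; _+_; _≤_; _<_; _∸_; z≤n; s≤s; _≡ᵇ_; _≤′_; ≤′-refl; ≤′-step)
open import Data.List using (List; []; _∷_; map; concatMap; _++_)
open import Data.Nat.ListAction using (sum)
open import Data.Nat.ListAction.Properties using (sum-++)
open import Data.Nat.Properties
  using (≤-refl; ≤-reflexive; ≤-pred; <⇒≤; <⇒≢; >⇒≢; <⇒≱; n≤1+n; n<1+n; m≤n⇒m≤1+n; m≤n+m; +-suc;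
         m+n∸m≡n; m≤n⇒∃[o]m+o≡n; m≤n⇒m<n∨m≡n; ≤⇒≤′; ≡ᵇ⇒≡; ≡⇒≡ᵇ)
open import Data.Sum using (inj₁; inj₂)
open import Data.Product using (Σ; _×_; _,_; proj₁; proj₂)
open import Data.Unit using (tt)
open import Function using (case_of_; Equivalence)
open import Relation.Binary.PropositionalEquality
open import Relation.Nullary using (contradiction)
open ≡-Reasoning

open CommutativeRing xor-∧-commutativeRing using (+-commutativeSemigroup)
open import Algebra.Properties.CommutativeSemigroup +-commutativeSemigroup
  renaming (interchange to xor-interchange)
  using ()

-- Used both as the swap pattern of an automorphism and, on one level, as a leaf pattern.
Pattern : Set
Pattern = ∀ {m} → Word m → Bool

xor-cancelˡ : ∀ a b → a xor (a xor b) ≡ b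
xor-cancelˡ a b = trans (sym (xor-assoc a a b)) (cong (_xor b) (xor-same a))

xor-cancelʳ : ∀ a b → (a xor b) xor b ≡ a
xor-cancelʳ a b = trans (xor-assoc a b b) (trans (cong (a xor_) (xor-same b)) (xor-identityʳ a))

xor≡false⇒≡ : ∀ {a b} → a xor b ≡ false → a ≡ b
xor≡false⇒≡ {a} {b} h = trans (sym (xor-cancelʳ a b)) (cong (_xor b) h)

xor-cancel-outer : ∀ s f t → ((s xor f) xor t) xor (s xor t) ≡ f
xor-cancel-outer s f t = begin
  ((s xor f) xor t) xor (s xor t)   ≡⟨ xor-assoc (s xor f) t (s xor t) ⟩
  (s xor f) xor (t xor (s xor t))   ≡⟨ cong (λ b → (s xor f) xor (t xor b)) (xor-comm s t) ⟩
  (s xor f) xor (t xor (t xor s))   ≡⟨ cong ((s xor f) xor_) (xor-cancelˡ t s) ⟩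
  (s xor f) xor s                   ≡⟨ xor-comm (s xor f) s ⟩
  s xor (s xor f)                   ≡⟨ xor-cancelˡ s f ⟩
  f                                 ∎

parity : ∀ m → (Word m → Bool) → Bool
parity zero    f = f ε
parity (suc m) f = parity m (λ w → f (w ▸ false)) xor parity m (λ w → f (w ▸ true))

parity-cong : ∀ m {f g : Word m → Bool} → (∀ w → f w ≡ g w) → parity m f ≡ parity m g
parity-cong zero    h = h ε
parity-cong (suc m) h = cong₂ _xor_ (parity-cong m (λ w → h (w ▸ false))) (parity-cong m (λ w → h (w ▸ true)))

parity-xor : ∀ m (f g : Word m → Bool) →
             parity m (λ w → f w xor g w) ≡ parity m f xor parity m g
parity-xor zero    f g = refl
parity-xor (suc m) f g = begin
  parity m (λ w → f (w ▸ false) xor g (w ▸ false)) xor parity m (λ w → f (w ▸ true) xor g (w ▸ true))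
    ≡⟨ cong₂ _xor_ (parity-xor m _ _) (parity-xor m _ _) ⟩
  (parity m (λ w → f (w ▸ false)) xor parity m (λ w → g (w ▸ false))) xor
  (parity m (λ w → f (w ▸ true)) xor parity m (λ w → g (w ▸ true)))
    ≡⟨ xor-interchange (parity m (λ w → f (w ▸ false))) _ (parity m (λ w → f (w ▸ true))) _ ⟩
  parity (suc m) f xor parity (suc m) g ∎

parity-false : ∀ m → parity m (λ _ → false) ≡ false
parity-false zero    = refl
parity-false (suc m) = cong (λ b → b xor b) (parity-false m)

parity-vanishes : ∀ m {f : Word m → Bool} → (∀ w → f w ≡ false) → parity m f ≡ false
parity-vanishes m h = trans (parity-cong m h) (parity-false m)

parity-const : ∀ m c → parity (suc m) (λ _ → c) ≡ false
parity-const m c = xor-same (parity m (λ _ → c))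

parity-∧ˡ : ∀ m c (f : Word m → Bool) → parity m (λ w → c ∧ f w) ≡ c ∧ parity m f
parity-∧ˡ m true  f = refl
parity-∧ˡ m false f = parity-false m

parity-swap : ∀ m k (f : Word m → Word k → Bool) →
              parity m (λ u → parity k (f u)) ≡ parity k (λ v → parity m (λ u → f u v))
parity-swap zero    k f = refl
parity-swap (suc m) k f =
  trans (cong₂ _xor_ (parity-swap m k (λ u → f (u ▸ false))) (parity-swap m k (λ u → f (u ▸ true))))
        (sym (parity-xor k _ _))

-- if a then b else not b is the comparison of letters used by eqW.

⇔-refl : ∀ a → (if a then a else not a) ≡ true
⇔-refl true  = refl
⇔-refl false = refl

⇔-sym : ∀ a b → (if a then b else not b) ≡ (if b then a else not a)
⇔-sym true  true  = refl
⇔-sym true  false = refl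
⇔-sym false true  = refl
⇔-sym false false = refl

⇔-xor : ∀ a b x → (if a xor x then b xor x else not (b xor x)) ≡ (if a then b else not b)
⇔-xor true  true  x = ⇔-refl (not x)
⇔-xor true  false true  = refl
⇔-xor true  false false = refl
⇔-xor false true  true  = refl
⇔-xor false true  false = refl
⇔-xor false false x = ⇔-refl x

-- Heterogeneous in the length, so that indicators z ↦ z == x are Patterns.
infix 5 _==_

_==_ : ∀ {m k} → Word m → Word k → Bool
ε       == ε       = true
ε       == (_ ▸ _) = false
(_ ▸ _) == ε       = false
(u ▸ a) == (v ▸ b) = (u == v) ∧ (if a then b else not b)

==-refl : ∀ {m} (w : Word m) → w == w ≡ true
==-refl ε       = refl
==-refl (w ▸ a) = cong₂ _∧_ (==-refl w) (⇔-refl a)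

==-sym : ∀ {m k} (u : Word m) (v : Word k) → u == v ≡ v == u
==-sym ε       ε       = refl
==-sym ε       (_ ▸ _) = refl
==-sym (_ ▸ _) ε       = refl
==-sym (u ▸ a) (v ▸ b) = cong₂ _∧_ (==-sym u v) (⇔-sym a b)

==⇒≡ : ∀ {m} {u v : Word m} → u == v ≡ true → u ≡ v
==⇒≡ {u = ε}     {ε}     _ = refl
==⇒≡ {u = u ▸ a} {v ▸ b} h with u == v in e
==⇒≡ {u = u ▸ true}  {v ▸ true}  h | true = cong (_▸ true) (==⇒≡ e)
==⇒≡ {u = u ▸ false} {v ▸ false} h | true = cong (_▸ false) (==⇒≡ e)

eqW≡== : ∀ {m} (u v : Word m) → eqW u v ≡ u == v
eqW≡== ε       ε       = refl
eqW≡== (u ▸ a) (v ▸ b) = cong (_∧ (if a then b else not b)) (eqW≡== u v)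

infixl 6 _+ʷ_

_+ʷ_ : ∀ {m} → Word m → Word m → Word m
ε       +ʷ ε       = ε
(u ▸ a) +ʷ (v ▸ b) = (u +ʷ v) ▸ (a xor b)

0ʷ : ∀ {m} → Word m
0ʷ {zero}  = ε
0ʷ {suc m} = 0ʷ ▸ false

+ʷ-comm : ∀ {m} (u v : Word m) → u +ʷ v ≡ v +ʷ u
+ʷ-comm ε       ε       = refl
+ʷ-comm (u ▸ a) (v ▸ b) = cong₂ _▸_ (+ʷ-comm u v) (xor-comm a b)

+ʷ-assoc : ∀ {m} (u v w : Word m) → (u +ʷ v) +ʷ w ≡ u +ʷ (v +ʷ w)
+ʷ-assoc ε       ε       ε       = refl
+ʷ-assoc (u ▸ a) (v ▸ b) (w ▸ c) = cong₂ _▸_ (+ʷ-assoc u v w) (xor-assoc a b c)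

+ʷ-self : ∀ {m} (u : Word m) → u +ʷ u ≡ 0ʷ
+ʷ-self ε       = refl
+ʷ-self (u ▸ a) = cong₂ _▸_ (+ʷ-self u) (xor-same a)

+ʷ-identityʳ : ∀ {m} (u : Word m) → u +ʷ 0ʷ ≡ u
+ʷ-identityʳ ε       = refl
+ʷ-identityʳ (u ▸ a) = cong₂ _▸_ (+ʷ-identityʳ u) (xor-identityʳ a)

+ʷ-identityˡ : ∀ {m} (u : Word m) → 0ʷ +ʷ u ≡ u
+ʷ-identityˡ u = trans (+ʷ-comm 0ʷ u) (+ʷ-identityʳ u)

+ʷ-cancelˡ : ∀ {m} (u v : Word m) → u +ʷ (u +ʷ v) ≡ v
+ʷ-cancelˡ u v = begin
  u +ʷ (u +ʷ v) ≡⟨ sym (+ʷ-assoc u u v) ⟩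
  (u +ʷ u) +ʷ v ≡⟨ cong (_+ʷ v) (+ʷ-self u) ⟩
  0ʷ +ʷ v       ≡⟨ +ʷ-identityˡ v ⟩
  v             ∎

+ʷ-interchange : ∀ {m} (x y u : Word m) → (x +ʷ y) +ʷ u ≡ (x +ʷ u) +ʷ y
+ʷ-interchange x y u = begin
  (x +ʷ y) +ʷ u ≡⟨ +ʷ-assoc x y u ⟩
  x +ʷ (y +ʷ u) ≡⟨ cong (x +ʷ_) (+ʷ-comm y u) ⟩
  x +ʷ (u +ʷ y) ≡⟨ sym (+ʷ-assoc x u y) ⟩
  (x +ʷ u) +ʷ y ∎

==-+ʷ : ∀ {m} (x v w : Word m) → (x +ʷ v) == w ≡ x == (w +ʷ v)
==-+ʷ ε       ε       ε       = refl
==-+ʷ (x ▸ a) (v ▸ b) (w ▸ c) = cong₂ _∧_ (==-+ʷ x v w) (⇔-move a b c)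
  where
  ⇔-move : ∀ a b c → (if a xor b then c else not c) ≡ (if a then c xor b else not (c xor b))
  ⇔-move a b c = trans (sym (cong (λ t → if a xor b then t else not t) (xor-cancelʳ c b))) (⇔-xor a (c xor b) b)

parity-δ : ∀ m (f : Word m → Bool) (y : Word m) → parity m (λ z → f z ∧ (z == y)) ≡ f y
parity-δ zero    f ε           = ∧-identityʳ (f ε)
parity-δ (suc m) f (y ▸ false) = begin
  parity m (λ z → f (z ▸ false) ∧ ((z == y) ∧ true)) xor parity m (λ z → f (z ▸ true) ∧ ((z == y) ∧ false))
    ≡⟨ cong₂ _xor_ (parity-cong m (λ z → cong (f (z ▸ false) ∧_) (∧-identityʳ (z == y))))
                   (parity-vanishes m (λ z → trans (cong (f (z ▸ true) ∧_) (∧-zeroʳ (z == y))) (∧-zeroʳ _))) ⟩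
  parity m (λ z → f (z ▸ false) ∧ (z == y)) xor false
    ≡⟨ xor-identityʳ _ ⟩
  parity m (λ z → f (z ▸ false) ∧ (z == y))
    ≡⟨ parity-δ m (λ z → f (z ▸ false)) y ⟩
  f (y ▸ false) ∎
parity-δ (suc m) f (y ▸ true)  = begin
  parity m (λ z → f (z ▸ false) ∧ ((z == y) ∧ false)) xor parity m (λ z → f (z ▸ true) ∧ ((z == y) ∧ true))
    ≡⟨ cong₂ _xor_ (parity-vanishes m (λ z → trans (cong (f (z ▸ false) ∧_) (∧-zeroʳ (z == y))) (∧-zeroʳ _)))
                   (parity-cong m (λ z → cong (f (z ▸ true) ∧_) (∧-identityʳ (z == y)))) ⟩
  parity m (λ z → f (z ▸ true) ∧ (z == y))
    ≡⟨ parity-δ m (λ z → f (z ▸ true)) y ⟩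
  f (y ▸ true) ∎

parity-translate : ∀ m (f : Word m → Bool) (v : Word m) → parity m (λ y → f (y +ʷ v)) ≡ parity m f
parity-translate zero    f ε           = refl
parity-translate (suc m) f (v ▸ false) =
  cong₂ _xor_ (parity-translate m (λ z → f (z ▸ false)) v) (parity-translate m (λ z → f (z ▸ true)) v)
parity-translate (suc m) f (v ▸ true)  =
  trans (cong₂ _xor_ (parity-translate m (λ z → f (z ▸ true)) v) (parity-translate m (λ z → f (z ▸ false)) v))
        (xor-comm (parity m (λ z → f (z ▸ true))) _)

parity-periodic : ∀ m (f : Word m → Bool) (z : Word m) → z == 0ʷ {m} ≡ false →
                  (∀ y → f (y +ʷ z) ≡ f y) → parity m f ≡ false
parity-periodic zero    f ε           ()  _
parity-periodic (suc m) f (z ▸ true)  _   periodic = begin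
  parity m (λ w → f (w ▸ false)) xor parity m (λ w → f (w ▸ true))
    ≡⟨ cong (_xor parity m (λ w → f (w ▸ true))) (begin
         parity m (λ w → f (w ▸ false))        ≡⟨ sym (parity-translate m (λ w → f (w ▸ false)) z) ⟩
         parity m (λ w → f ((w +ʷ z) ▸ false)) ≡⟨ parity-cong m (λ w → periodic (w ▸ true)) ⟩
         parity m (λ w → f (w ▸ true))         ∎) ⟩
  parity m (λ w → f (w ▸ true)) xor parity m (λ w → f (w ▸ true))
    ≡⟨ xor-same (parity m (λ w → f (w ▸ true))) ⟩
  false ∎
parity-periodic (suc m) f (z ▸ false) z≢0 periodic =
  cong₂ _xor_ (parity-periodic m _ z z≢0′ (λ y → periodic (y ▸ false)))
              (parity-periodic m _ z z≢0′ (λ y → periodic (y ▸ true)))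
  where
  z≢0′ : z == 0ʷ {m} ≡ false
  z≢0′ = trans (sym (∧-identityʳ (z == 0ʷ {m}))) z≢0

-- The terms at y and y +ʷ z coincide, so for z ≠ 0 they cancel in pairs.
parity-autocorrelation : ∀ m (c : Word m → Bool) → parity m c ≡ true →
                         ∀ z → parity m (λ y → c y ∧ c (z +ʷ y)) ≡ z == 0ʷ {m}
parity-autocorrelation m c c-odd z with z == 0ʷ {m} in z≟0
... | true  = trans (parity-cong m (λ y → trans (cong (λ t → c y ∧ c t) (0+y≡y y)) (∧-idem (c y)))) c-odd
  where
  0+y≡y : ∀ y → z +ʷ y ≡ y
  0+y≡y y = trans (cong (_+ʷ y) (==⇒≡ z≟0)) (+ʷ-identityˡ y)
... | false = parity-periodic m _ z z≟0 (λ y → begin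
  c (y +ʷ z) ∧ c (z +ʷ (y +ʷ z)) ≡⟨ cong (λ t → c (y +ʷ z) ∧ c (z +ʷ t)) (+ʷ-comm y z) ⟩
  c (y +ʷ z) ∧ c (z +ʷ (z +ʷ y)) ≡⟨ cong (λ t → c (y +ʷ z) ∧ c t) (+ʷ-cancelˡ z y) ⟩
  c (y +ʷ z) ∧ c y               ≡⟨ ∧-comm (c (y +ʷ z)) (c y) ⟩
  c y ∧ c (y +ʷ z)               ≡⟨ cong (λ t → c y ∧ c t) (+ʷ-comm y z) ⟩
  c y ∧ c (z +ʷ y)               ∎)

odd : ℕ → Bool
odd zero    = false
odd (suc n) = not (odd n)

odd-+ : ∀ a b → odd (a + b) ≡ odd a xor odd b
odd-+ zero    b = refl
odd-+ (suc a) b = trans (cong not (odd-+ a b)) (not-distribˡ-xor (odd a) (odd b))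

odd-indicator : ∀ b → odd (if b then 1 else 0) ≡ b
odd-indicator true  = refl
odd-indicator false = refl

isEven≡not-odd : ∀ n → isEven n ≡ not (odd n)
isEven≡not-odd zero          = refl
isEven≡not-odd (suc zero)    = refl
isEven≡not-odd (suc (suc n)) = trans (isEven≡not-odd n) (cong not (sym (not-involutive (odd n))))

isEven≡false⇒odd : ∀ n → isEven n ≡ false → odd n ≡ true
isEven≡false⇒odd n h = trans (sym (not-involutive (odd n))) (cong not (trans (sym (isEven≡not-odd n)) h))

xorOver : ∀ {A : Set} → List A → (A → Bool) → Bool
xorOver []       f = false
xorOver (x ∷ xs) f = f x xor xorOver xs f

xorOver-cong : ∀ {A : Set} (xs : List A) {f g : A → Bool} → (∀ x → f x ≡ g x) → xorOver xs f ≡ xorOver xs g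
xorOver-cong []       h = refl
xorOver-cong (x ∷ xs) h = cong₂ _xor_ (h x) (xorOver-cong xs h)

xorOver-++ : ∀ {A : Set} (xs ys : List A) (f : A → Bool) →
             xorOver (xs ++ ys) f ≡ xorOver xs f xor xorOver ys f
xorOver-++ []       ys f = refl
xorOver-++ (x ∷ xs) ys f =
  trans (cong (f x xor_) (xorOver-++ xs ys f)) (sym (xor-assoc (f x) (xorOver xs f) (xorOver ys f)))

xorOver-concatMap : ∀ {A B : Set} (g : A → List B) (xs : List A) (f : B → Bool) →
                    xorOver (concatMap g xs) f ≡ xorOver xs (λ x → xorOver (g x) f)
xorOver-concatMap g []       f = refl
xorOver-concatMap g (x ∷ xs) f =
  trans (xorOver-++ (g x) (concatMap g xs) f) (cong (xorOver (g x) f xor_) (xorOver-concatMap g xs f))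

xorOver-allWords : ∀ m (f : Word m → Bool) → xorOver (allWords m) f ≡ parity m f
xorOver-allWords zero    f = xor-identityʳ (f ε)
xorOver-allWords (suc m) f = begin
  xorOver (concatMap (λ w → (w ▸ false) ∷ (w ▸ true) ∷ []) (allWords m)) f
    ≡⟨ xorOver-concatMap _ (allWords m) f ⟩
  xorOver (allWords m) (λ w → f (w ▸ false) xor (f (w ▸ true) xor false))
    ≡⟨ xorOver-cong (allWords m) (λ w → cong (f (w ▸ false) xor_) (xor-identityʳ (f (w ▸ true)))) ⟩
  xorOver (allWords m) (λ w → f (w ▸ false) xor f (w ▸ true))
    ≡⟨ xorOver-allWords m _ ⟩
  parity m (λ w → f (w ▸ false) xor f (w ▸ true))
    ≡⟨ parity-xor m _ _ ⟩
  parity (suc m) f ∎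

odd-sum-map : ∀ {A : Set} (g : A → ℕ) (xs : List A) → odd (sum (map g xs)) ≡ xorOver xs (λ x → odd (g x))
odd-sum-map g []       = refl
odd-sum-map g (x ∷ xs) = trans (odd-+ (g x) (sum (map g xs))) (cong (odd (g x) xor_) (odd-sum-map g xs))

odd-sum-concatMap : ∀ {A : Set} (g : A → List ℕ) (xs : List A) →
                    odd (sum (concatMap g xs)) ≡ xorOver xs (λ x → odd (sum (g x)))
odd-sum-concatMap g []       = refl
odd-sum-concatMap g (x ∷ xs) = begin
  odd (sum (g x ++ concatMap g xs))                ≡⟨ cong odd (sum-++ (g x) (concatMap g xs)) ⟩
  odd (sum (g x) + sum (concatMap g xs))           ≡⟨ odd-+ (sum (g x)) _ ⟩
  odd (sum (g x)) xor odd (sum (concatMap g xs))   ≡⟨ cong (odd (sum (g x)) xor_) (odd-sum-concatMap g xs) ⟩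
  xorOver (x ∷ xs) (λ y → odd (sum (g y)))         ∎

odd-count : ∀ {A : Set} (P : A → Bool) (xs : List A) → odd (count P xs) ≡ xorOver xs P
odd-count P []       = refl
odd-count P (x ∷ xs) =
  trans (odd-+ (if P x then 1 else 0) (count P xs)) (cong₂ _xor_ (odd-indicator (P x)) (odd-count P xs))

odd-inversions : ∀ m (p : Word m → Word m) →
                 odd (inversions p) ≡ parity m (λ u → parity m (λ v → ltW u v ∧ ltW (p v) (p u)))
odd-inversions m p = begin
  odd (inversions p)
    ≡⟨ odd-sum-concatMap _ (allWords m) ⟩
  xorOver (allWords m) (λ u → odd (sum (map (λ v → if ltW u v ∧ ltW (p v) (p u) then 1 else 0) (allWords m))))
    ≡⟨ xorOver-cong (allWords m) (λ u → begin
         odd (sum (map (λ v → if ltW u v ∧ ltW (p v) (p u) then 1 else 0) (allWords m)))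
           ≡⟨ odd-sum-map _ (allWords m) ⟩
         xorOver (allWords m) (λ v → odd (if ltW u v ∧ ltW (p v) (p u) then 1 else 0))
           ≡⟨ xorOver-cong (allWords m) (λ v → odd-indicator (ltW u v ∧ ltW (p v) (p u))) ⟩
         xorOver (allWords m) (λ v → ltW u v ∧ ltW (p v) (p u))
           ≡⟨ xorOver-allWords m _ ⟩
         parity m (λ v → ltW u v ∧ ltW (p v) (p u)) ∎) ⟩
  xorOver (allWords m) (λ u → parity m (λ v → ltW u v ∧ ltW (p v) (p u)))
    ≡⟨ xorOver-allWords m _ ⟩
  parity m (λ u → parity m (λ v → ltW u v ∧ ltW (p v) (p u))) ∎

isMinus-if : ∀ b → isMinus (if b then plus else minus) ≡ not b
isMinus-if true  = refl
isMinus-if false = refl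

isMinus-sign : ∀ {m} (p : Word m → Word m) → isMinus (sign p) ≡ odd (inversions p)
isMinus-sign p = begin
  isMinus (sign p)               ≡⟨ isMinus-if (isEven (inversions p)) ⟩
  not (isEven (inversions p))    ≡⟨ cong not (isEven≡not-odd (inversions p)) ⟩
  not (not (odd (inversions p))) ≡⟨ not-involutive _ ⟩
  odd (inversions p)             ∎

last : ∀ {m} → Word (suc m) → Bool
last (_ ▸ b) = b

fromSwaps : Pattern → Map
fromSwaps c ε       = ε
fromSwaps c (s ▸ b) = fromSwaps c s ▸ (b xor c s)

unswap : Pattern → Map
unswap c ε       = ε
unswap c (w ▸ b) = unswap c w ▸ (b xor c (unswap c w))

fromSwaps-unswap : ∀ (c : Pattern) {m} (w : Word m) → fromSwaps c (unswap c w) ≡ w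
fromSwaps-unswap c ε       = refl
fromSwaps-unswap c (w ▸ b) = cong₂ _▸_ (fromSwaps-unswap c w) (xor-cancelʳ b (c (unswap c w)))

unswap-fromSwaps : ∀ (c : Pattern) {m} (w : Word m) → unswap c (fromSwaps c w) ≡ w
unswap-fromSwaps c ε       = refl
unswap-fromSwaps c (w ▸ b) rewrite unswap-fromSwaps c w = cong (w ▸_) (xor-cancelʳ b (c w))

fromSwaps-isAut : (c : Pattern) → IsAutInf (fromSwaps c)
fromSwaps-isAut c = record
  { parentPres = λ _ _ _ → refl
  ; bijective  = λ _ → injective , λ w → unswap c w , λ { refl → fromSwaps-unswap c w }
  }
  where
  injective : ∀ {m} {x y : Word m} → fromSwaps c x ≡ fromSwaps c y → x ≡ y
  injective {x = x} {y} h = trans (sym (unswap-fromSwaps c x)) (trans (cong (unswap c) h) (unswap-fromSwaps c y))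

fromSwaps-involutive : ∀ (c : Pattern) → (∀ {m} (z : Word m) → c (fromSwaps c z) ≡ c z) →
                       ∀ {m} (w : Word m) → fromSwaps c (fromSwaps c w) ≡ w
fromSwaps-involutive c c-invariant ε       = refl
fromSwaps-involutive c c-invariant (w ▸ b) =
  cong₂ _▸_ (fromSwaps-involutive c c-invariant w)
            (trans (cong ((b xor c w) xor_) (c-invariant w)) (xor-cancelʳ b (c w)))

fromSwaps-cong-below : ∀ (c c′ : Pattern) {m} (x : Word m) →
                       (∀ {j} (z : Word j) → j < m → c z ≡ c′ z) → fromSwaps c x ≡ fromSwaps c′ x
fromSwaps-cong-below c c′ ε       h = refl
fromSwaps-cong-below c c′ (x ▸ b) h =
  cong₂ _▸_ (fromSwaps-cong-below c c′ x (λ z j<m → h z (m≤n⇒m≤1+n j<m))) (cong (b xor_) (h x ≤-refl))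

fromSwaps-== : ∀ (c : Pattern) {m} (u v : Word m) → fromSwaps c u == fromSwaps c v ≡ u == v
fromSwaps-== c ε       ε       = refl
fromSwaps-== c (u ▸ a) (v ▸ b) rewrite fromSwaps-== c u v with u == v in u≟v
... | true  = trans (cong (λ t → if a xor c t then b xor c v else not (b xor c v)) (==⇒≡ u≟v))
                    (⇔-xor a b (c v))
... | false = refl

==-fromSwaps : ∀ (c : Pattern) → (∀ {m} (z : Word m) → c (fromSwaps c z) ≡ c z) →
               ∀ {m} (x w : Word m) → fromSwaps c x == w ≡ x == fromSwaps c w
==-fromSwaps c c-invariant x w =
  trans (cong (fromSwaps c x ==_) (sym (fromSwaps-involutive c c-invariant w))) (fromSwaps-== c x (fromSwaps c w))

eqW-refl : ∀ {m} (w : Word m) → eqW w w ≡ true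
eqW-refl w = trans (eqW≡== w w) (==-refl w)

ltW-irrefl : ∀ {m} (w : Word m) → ltW w w ≡ false
ltW-irrefl ε       = refl
ltW-irrefl (w ▸ a) rewrite ltW-irrefl w | eqW-refl w = not-a∧a a
  where
  not-a∧a : ∀ a → not a ∧ a ≡ false
  not-a∧a true  = refl
  not-a∧a false = refl

Σ₂ : (Bool → Bool → Bool) → Bool
Σ₂ g = (g false false xor g false true) xor (g true false xor g true true)

Σ₂-const : ∀ x → Σ₂ (λ _ _ → x) ≡ false
Σ₂-const x = cong (λ y → y xor y) (xor-same x)

parity-suc² : ∀ m (h : Word (suc m) → Word (suc m) → Bool) →
              parity (suc m) (λ U → parity (suc m) (h U)) ≡
              parity m (λ u → parity m (λ v → Σ₂ (λ a b → h (u ▸ a) (v ▸ b))))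
parity-suc² m h = begin
  parity (suc m) (λ U → parity (suc m) (h U))
    ≡⟨ sym (parity-xor m _ _) ⟩
  parity m (λ u → parity (suc m) (h (u ▸ false)) xor parity (suc m) (h (u ▸ true)))
    ≡⟨ parity-cong m (λ u → cong₂ _xor_ (sym (parity-xor m _ _)) (sym (parity-xor m _ _))) ⟩
  parity m (λ u → parity m (λ v → h (u ▸ false) (v ▸ false) xor h (u ▸ false) (v ▸ true)) xor
                  parity m (λ v → h (u ▸ true) (v ▸ false) xor h (u ▸ true) (v ▸ true)))
    ≡⟨ parity-cong m (λ u → sym (parity-xor m _ _)) ⟩
  parity m (λ u → parity m (λ v → Σ₂ (λ a b → h (u ▸ a) (v ▸ b)))) ∎

-- Among pairs of words extending u and v by one letter, inversions of
-- fromSwaps c occur in even number unless u = v, where the last letter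
-- is inverted exactly when c swaps below u.
inversions-below : ∀ (c : Pattern) {m} (u v : Word m) →
  Σ₂ (λ a b → ltW (u ▸ a) (v ▸ b) ∧ ltW (fromSwaps c (v ▸ b)) (fromSwaps c (u ▸ a))) ≡ c u ∧ (v == u)
inversions-below c u v with u == v in u≟v
... | true with ==⇒≡ {u = u} {v} u≟v
...   | refl rewrite ltW-irrefl u | eqW-refl u | ltW-irrefl (fromSwaps c u) | eqW-refl (fromSwaps c u)
                   | ==-refl u = same-node (c u)
  where
  same-node : ∀ x → Σ₂ (λ a b → (not a ∧ b) ∧ (not (b xor x) ∧ (a xor x))) ≡ x ∧ true
  same-node true  = refl
  same-node false = refl
inversions-below c u v | false
  rewrite eqW≡== u v | u≟v | eqW≡== (fromSwaps c v) (fromSwaps c u) | fromSwaps-== c v u | ==-sym v u | u≟v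
  = trans (Σ₂-const ((ltW u v ∨ false) ∧ (ltW (fromSwaps c v) (fromSwaps c u) ∨ false))) (sym (∧-zeroʳ (c u)))

sign-fromSwaps : ∀ m (c : Pattern) (q : Word (suc m) → Word (suc m)) → (∀ s → q s ≡ fromSwaps c s) →
                 isMinus (sign q) ≡ parity m c
sign-fromSwaps m c q q≗ = begin
  isMinus (sign q)
    ≡⟨ isMinus-sign q ⟩
  odd (inversions q)
    ≡⟨ odd-inversions (suc m) q ⟩
  parity (suc m) (λ U → parity (suc m) (λ V → ltW U V ∧ ltW (q V) (q U)))
    ≡⟨ parity-cong (suc m) (λ U → parity-cong (suc m) (λ V →
         cong₂ (λ x y → ltW U V ∧ ltW x y) (q≗ V) (q≗ U))) ⟩
  parity (suc m) (λ U → parity (suc m) (λ V → ltW U V ∧ ltW (fromSwaps c V) (fromSwaps c U)))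
    ≡⟨ parity-suc² m (λ U V → ltW U V ∧ ltW (fromSwaps c V) (fromSwaps c U)) ⟩
  parity m (λ u → parity m (λ v → Σ₂ (λ a b → ltW (u ▸ a) (v ▸ b) ∧ ltW (fromSwaps c (v ▸ b)) (fromSwaps c (u ▸ a)))))
    ≡⟨ parity-cong m (λ u → parity-cong m (inversions-below c u)) ⟩
  parity m (λ u → parity m (λ v → c u ∧ (v == u)))
    ≡⟨ parity-cong m (λ u → parity-δ m (λ _ → c u) u) ⟩
  parity m c ∎

swaps : Map → Pattern
swaps τ z = last (τ (z ▸ false))

suffix-⊕ : ∀ {k j} (y : Word k) (w : Word j) → suffix j (y ⊕ w) ≡ w
suffix-⊕ y ε       = refl
suffix-⊕ y (w ▸ b) = cong (_▸ b) (suffix-⊕ y w)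

module _ {τ : Map} (aut : IsAutInf τ) where
  open IsAutOn aut

  aut-▸ : ∀ {m} (z : Word m) b → τ (z ▸ b) ≡ τ z ▸ (b xor swaps τ z)
  aut-▸ z b = trans (η (τ (z ▸ b))) (cong₂ _▸_ (parentPres z b tt) (last-letter b))
    where
    η : ∀ {m} (u : Word (suc m)) → u ≡ parent u ▸ last u
    η (_ ▸ _) = refl
    children-differ : last (τ (z ▸ true)) ≢ last (τ (z ▸ false))
    children-differ same = case proj₁ (bijective tt) (begin
      τ (z ▸ true)                                  ≡⟨ η (τ (z ▸ true)) ⟩
      parent (τ (z ▸ true)) ▸ last (τ (z ▸ true))   ≡⟨ cong₂ _▸_ same-parent same ⟩
      parent (τ (z ▸ false)) ▸ last (τ (z ▸ false)) ≡⟨ sym (η (τ (z ▸ false))) ⟩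
      τ (z ▸ false)                                 ∎) of λ ()
      where
      same-parent : parent (τ (z ▸ true)) ≡ parent (τ (z ▸ false))
      same-parent = trans (parentPres z true tt) (sym (parentPres z false tt))
    last-letter : ∀ b → last (τ (z ▸ b)) ≡ b xor swaps τ z
    last-letter false = refl
    last-letter true  = ¬-not children-differ

  aut-⊕ : ∀ {k} (y : Word k) {j} (s : Word j) → τ (y ⊕ s) ≡ τ y ⊕ fromSwaps (λ t → swaps τ (y ⊕ t)) s
  aut-⊕ y ε       = refl
  aut-⊕ y (s ▸ b) = trans (aut-▸ (y ⊕ s) b) (cong (_▸ (b xor swaps τ (y ⊕ s))) (aut-⊕ y s))

  sgn-aut : (σ : Map) → ∀ m {k} (y : Word k) → (∀ (s : Word (suc m)) → σ (y ⊕ s) ≡ τ (y ⊕ s)) →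
            isMinus (sgn (suc m) σ y) ≡ parity m (λ s → swaps τ (y ⊕ s))
  sgn-aut σ m y σ≗τ = sign-fromSwaps m (λ t → swaps τ (y ⊕ t)) _ (λ s → begin
    suffix (suc m) (σ (y ⊕ s))                                 ≡⟨ cong (suffix (suc m)) (σ≗τ s) ⟩
    suffix (suc m) (τ (y ⊕ s))                                 ≡⟨ cong (suffix (suc m)) (aut-⊕ y s) ⟩
    suffix (suc m) (τ y ⊕ fromSwaps (λ t → swaps τ (y ⊕ t)) s) ≡⟨ suffix-⊕ (τ y) _ ⟩
    fromSwaps (λ t → swaps τ (y ⊕ t)) s                        ∎)

isMinus≡false⇒plus : ∀ {s} → isMinus s ≡ false → s ≡ plus
isMinus≡false⇒plus {plus} _ = refl

Mℓ-parity : ∀ m {τ : Map} → InMℓ (suc m) τ → ∀ {k} (y : Word k) → parity m (λ s → swaps τ (y ⊕ s)) ≡ false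
Mℓ-parity m {τ} (aut , even) y = trans (sym (sgn-aut aut τ m y (λ _ → refl))) (cong isMinus (even y))

fromSwaps-Mℓ : ∀ m (c : Pattern) → (∀ {k} (y : Word k) → parity m (λ s → c (y ⊕ s)) ≡ false) →
               InMℓ (suc m) (fromSwaps c)
fromSwaps-Mℓ m c even = fromSwaps-isAut c , λ y →
  isMinus≡false⇒plus (trans (sgn-aut (fromSwaps-isAut c) (fromSwaps c) m y (λ _ → refl)) (even y))

≡ᵇ-refl : ∀ m → (m ≡ᵇ m) ≡ true
≡ᵇ-refl m = Equivalence.to T-≡ (≡⇒≡ᵇ m m refl)

≡ᵇ-true⇒≡ : ∀ {m n} → (m ≡ᵇ n) ≡ true → m ≡ n
≡ᵇ-true⇒≡ {m} {n} h = ≡ᵇ⇒≡ m n (Equivalence.from T-≡ h)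

≢⇒≡ᵇ-false : ∀ {m n} → m ≢ n → (m ≡ᵇ n) ≡ false
≢⇒≡ᵇ-false {m} {n} m≢n with m ≡ᵇ n in e
... | true  = contradiction (≡ᵇ-true⇒≡ e) m≢n
... | false = refl

-- Letters are indexed by position from the root: letter w j is the letter
-- added on the way from level j to level j + 1 (false beyond the length of w).
letter : ∀ {m} → Word m → ℕ → Bool
letter ε               j = false
letter {suc m} (w ▸ b) j = if j ≡ᵇ m then b else letter w j

unit : ℕ → ∀ m → Word m
unit i zero    = ε
unit i (suc m) = unit i m ▸ (m ≡ᵇ i)

letter-+ʷ : ∀ {m} (u v : Word m) j → letter (u +ʷ v) j ≡ letter u j xor letter v j
letter-+ʷ ε               ε       j = refl
letter-+ʷ {suc m} (u ▸ a) (v ▸ b) j with j ≡ᵇ m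
... | true  = refl
... | false = letter-+ʷ u v j

letter-unit : ∀ i m j → j ≢ i → letter (unit i m) j ≡ false
letter-unit i zero    j j≢i = refl
letter-unit i (suc m) j j≢i with j ≡ᵇ m in e
... | true  = ≢⇒≡ᵇ-false (λ m≡i → j≢i (trans (≡ᵇ-true⇒≡ e) m≡i))
... | false = letter-unit i m j j≢i

letter-high : ∀ {m} (w : Word m) j → m ≤ j → letter w j ≡ false
letter-high ε               j _   = refl
letter-high {suc m} (w ▸ b) j m<j rewrite ≢⇒≡ᵇ-false (>⇒≢ m<j) = letter-high w j (<⇒≤ m<j)

letter-⊕ : ∀ {k} (w : Word (suc k)) {j} (t : Word j) → letter (w ⊕ t) k ≡ last w
letter-⊕ {k} (w ▸ b) ε       rewrite ≡ᵇ-refl k = refl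
letter-⊕ {k} w {suc j} (t ▸ c) rewrite ≢⇒≡ᵇ-false (<⇒≢ (m≤n+m (suc k) j)) = letter-⊕ w t

unit-high : ∀ i m → m ≤ i → unit i m ≡ 0ʷ
unit-high i zero    _   = refl
unit-high i (suc m) m<i rewrite ≢⇒≡ᵇ-false (<⇒≢ m<i) = cong (_▸ false) (unit-high i m (<⇒≤ m<i))

translation : ∀ {N} → Word N → Map
translation v = fromSwaps (λ {j} _ → letter v j)

translation-+ʷ : ∀ {N} (x v : Word N) → translation v x ≡ x +ʷ v
translation-+ʷ ε               ε       = refl
translation-+ʷ {suc N} (x ▸ a) (v ▸ b) rewrite ≡ᵇ-refl N = cong (_▸ (a xor b)) (begin
  fromSwaps (λ {j} _ → letter (v ▸ b) j) x
    ≡⟨ fromSwaps-cong-below _ _ x (λ {j} _ j<N → cong (if_then b else letter v j) (≢⇒≡ᵇ-false (<⇒≢ j<N))) ⟩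
  translation v x                          ≡⟨ translation-+ʷ x v ⟩
  x +ʷ v                                   ∎)

translation-involutive : ∀ {N} (v : Word N) {m} (w : Word m) → translation v (translation v w) ≡ w
translation-involutive v = fromSwaps-involutive _ (λ _ → refl)

transvectionSwaps : ℕ → Pattern
transvectionSwaps j {zero}  _ = false
transvectionSwaps j {suc m} z = (m ≡ᵇ j) ∧ last z

-- transvection j adds the letter at position j to the letter at position j + 1.
transvection : ℕ → Map
transvection j = fromSwaps (transvectionSwaps j)

transvectionSwaps-letter : ∀ j {M} (w : Word M) → transvectionSwaps j w ≡ letter w j ∧ (M ≡ᵇ suc j)
transvectionSwaps-letter j ε               = refl
transvectionSwaps-letter j {suc m} (w ▸ c) with m ≡ᵇ j in e
... | true  rewrite ≡ᵇ-true⇒≡ {m} {j} e | ≡ᵇ-refl j = sym (∧-identityʳ c)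
... | false = sym (∧-zeroʳ _)

transvectionSwaps-invariant : ∀ j {m} (z : Word m) → transvectionSwaps j (transvection j z) ≡ transvectionSwaps j z
transvectionSwaps-invariant j {zero}  z       = refl
transvectionSwaps-invariant j {suc m} (z ▸ c) with m ≡ᵇ j in e
... | false = refl
... | true  rewrite ≡ᵇ-true⇒≡ {m} {j} e | transvectionSwaps-letter j z | letter-high z j ≤-refl = xor-identityʳ c

transvection-involutive : ∀ j {m} (w : Word m) → transvection j (transvection j w) ≡ w
transvection-involutive j = fromSwaps-involutive (transvectionSwaps j) (transvectionSwaps-invariant j)

-- Over two or more levels the swaps of a transvection cancel in pairs,
-- since they do not depend on the letter above the last one.
transvection-parity : ∀ j d {k} (y : Word k) → parity (suc (suc d)) (λ s → transvectionSwaps j (y ⊕ s)) ≡ false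
transvection-parity j d y =
  cong₂ _xor_ (xor-same (parity d (λ w → transvectionSwaps j (y ⊕ (w ▸ false ▸ false)))))
              (xor-same (parity d (λ w → transvectionSwaps j (y ⊕ (w ▸ false ▸ true)))))

transvection-0ʷ : ∀ j {m} → transvection j (0ʷ {m}) ≡ 0ʷ
transvection-0ʷ j {zero}        = refl
transvection-0ʷ j {suc zero}    = refl
transvection-0ʷ j {suc (suc m)} = cong₂ _▸_ (transvection-0ʷ j {suc m}) (∧-zeroʳ (m ≡ᵇ j))

transvection-unit : ∀ j m → transvection j (unit j m) ≡ unit j m +ʷ unit (suc j) m
transvection-unit j zero          = refl
transvection-unit j (suc zero)    = refl
transvection-unit j (suc (suc m)) =
  cong₂ _▸_ (transvection-unit j (suc m)) (cong ((suc m ≡ᵇ j) xor_) (∧-idem (m ≡ᵇ j)))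

transvection-eval : ∀ j {M} (w : Word M) →
                    transvection j w ≡ (if letter w j then w +ʷ unit (suc j) M else w)
transvection-eval j ε = refl
transvection-eval j {suc M} (w ▸ c)
  rewrite transvectionSwaps-letter j w | transvection-eval j w with j ≡ᵇ M in e
... | false with letter w j
...   | true  = refl
...   | false = cong (w ▸_) (xor-identityʳ c)
transvection-eval j {suc M} (w ▸ c) | true with ≡ᵇ-true⇒≡ {j} {M} e
... | refl rewrite letter-high w j ≤-refl | unit-high (suc j) j (n≤1+n j) | ≢⇒≡ᵇ-false (<⇒≢ (n<1+n j))
  = last-level c
  where
  last-level : ∀ c → w ▸ (c xor false) ≡ (if c then (w +ʷ 0ʷ) ▸ (c xor false) else w ▸ c)
  last-level false = refl
  last-level true  = cong (_▸ true) (sym (+ʷ-identityʳ w))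

blockParity : ℕ → Pattern → Pattern
blockParity zero    F = F
blockParity (suc j) F = blockParity j (λ z → F (z ▸ false) xor F (z ▸ true))

blockParity≡parity : ∀ j (F : Pattern) {k} (y : Word k) → blockParity j F y ≡ parity j (λ t → F (y ⊕ t))
blockParity≡parity zero    F y = refl
blockParity≡parity (suc j) F y =
  trans (blockParity≡parity j (λ z → F (z ▸ false) xor F (z ▸ true)) y) (parity-xor j _ _)

blockParity-suc : ∀ j (F : Pattern) {k} (y : Word k) →
                  blockParity (suc j) F y ≡ blockParity j F (y ▸ false) xor blockParity j F (y ▸ true)
blockParity-suc zero    F y = refl
blockParity-suc (suc j) F y = blockParity-suc j (λ z → F (z ▸ false) xor F (z ▸ true)) y

blockParity-children : ∀ j (F : Pattern) {k} (y : Word k) → blockParity (suc j) F y ≡ false →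
                       ∀ b → blockParity j F (y ▸ b) ≡ blockParity j F (y ▸ false)
blockParity-children j F y even false = refl
blockParity-children j F y even true  = sym (xor≡false⇒≡ (trans (sym (blockParity-suc j F y)) even))

blockParity-cong : ∀ j {F F′ : Pattern} → (∀ {m} (z : Word m) → F z ≡ F′ z) →
                   ∀ {k} (y : Word k) → blockParity j F y ≡ blockParity j F′ y
blockParity-cong zero    h y = h y
blockParity-cong (suc j) h y = blockParity-cong j (λ z → cong₂ _xor_ (h (z ▸ false)) (h (z ▸ true))) y

blockParity-xor : ∀ j (F F′ : Pattern) {k} (y : Word k) →
                  blockParity j (λ z → F z xor F′ z) y ≡ blockParity j F y xor blockParity j F′ y
blockParity-xor j F F′ y = begin
  blockParity j (λ z → F z xor F′ z) y
    ≡⟨ blockParity≡parity j _ y ⟩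
  parity j (λ t → F (y ⊕ t) xor F′ (y ⊕ t))
    ≡⟨ parity-xor j _ _ ⟩
  parity j (λ t → F (y ⊕ t)) xor parity j (λ t → F′ (y ⊕ t))
    ≡⟨ sym (cong₂ _xor_ (blockParity≡parity j F y) (blockParity≡parity j F′ y)) ⟩
  blockParity j F y xor blockParity j F′ y ∎

blockParity-sum : ∀ j m (a : Word m → Bool) (P : Word m → Pattern) {k} (y : Word k) →
  blockParity j (λ z → parity m (λ p → a p ∧ P p z)) y ≡ parity m (λ p → a p ∧ blockParity j (P p) y)
blockParity-sum j m a P y = begin
  blockParity j (λ z → parity m (λ p → a p ∧ P p z)) y
    ≡⟨ blockParity≡parity j _ y ⟩
  parity j (λ t → parity m (λ p → a p ∧ P p (y ⊕ t)))
    ≡⟨ parity-swap j m _ ⟩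
  parity m (λ p → parity j (λ t → a p ∧ P p (y ⊕ t)))
    ≡⟨ parity-cong m (λ p → trans (parity-∧ˡ j (a p) _) (cong (a p ∧_) (sym (blockParity≡parity j (P p) y)))) ⟩
  parity m (λ p → a p ∧ blockParity j (P p) y) ∎

parity-blocks : ∀ j m (F : Pattern) → parity (j + m) F ≡ parity m (blockParity j F)
parity-blocks zero    m F = refl
parity-blocks (suc j) m F =
  trans (sym (parity-xor (j + m) _ _)) (parity-blocks j m (λ z → F (z ▸ false) xor F (z ▸ true)))

blockParity-δ : ∀ j (t : Word j) {k} (w : Word k) {k′} (y : Word k′) →
                blockParity j (λ z → z == (w ⊕ t)) y ≡ y == w
blockParity-δ zero    ε       w y = refl
blockParity-δ (suc j) (t ▸ c) w y =
  trans (blockParity-cong j (λ z → one-child (z == (w ⊕ t)) c) y) (blockParity-δ j t w y)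
  where
  one-child : ∀ x c → (x ∧ (if false then c else not c)) xor (x ∧ (if true then c else not c)) ≡ x
  one-child true  true  = refl
  one-child true  false = refl
  one-child false c     = refl

ε⊕ : ∀ (A : Pattern) {k} (s : Word k) → A (ε ⊕ s) ≡ A s
ε⊕ A ε       = refl
ε⊕ A (s ▸ b) = ε⊕ (λ z → A (z ▸ b)) s

spike : ∀ j {m} → Word m → Bool → Word (j + suc m)
spike j y b = (y ▸ b) ⊕ 0ʷ {j}

spike-true : ∀ j {m} (y : Word m) → spike j y true ≡ spike j y false +ʷ unit m (j + suc m)
spike-true zero    {m} y rewrite unit-high m m ≤-refl | +ʷ-identityʳ y | ≡ᵇ-refl m = refl
spike-true (suc j) {m} y rewrite ≢⇒≡ᵇ-false (>⇒≢ (m≤n+m (suc m) j)) = cong (_▸ false) (spike-true j y)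

pair : ∀ {k k′} → Word k → Word k′ → Pattern
pair x x′ z = (z == x) xor (z == x′)

==-unit-cast : ∀ {M N} → M ≡ N → ∀ i (z : Word N) (s : Word M) → z == (s +ʷ unit i M) ≡ (z +ʷ unit i N) == s
==-unit-cast refl i z s = sym (==-+ʷ z (unit i _) s)

parity-==-cast : ∀ {M N} → M ≡ N → (w : Word M) → parity N (λ y → y == w) ≡ true
parity-==-cast refl w = parity-δ _ (λ _ → true) w

module Spanning (d e : ℕ) (W : Pattern → Set)
  (W-ext : ∀ {F F′ : Pattern} → (∀ (x : Word (suc (d + e))) → F x ≡ F′ x) → W F → W F′)
  (W-false : W (λ _ → false))
  (W-xor : ∀ {F F′ : Pattern} → W F → W F′ → W (λ z → F z xor F′ z))
  (W-precompose : ∀ (A : Pattern) → (∀ {k} (y : Word k) → parity (suc d) (λ s → A (y ⊕ s)) ≡ false) →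
                  (∀ {m} (w : Word m) → fromSwaps A (fromSwaps A w) ≡ w) →
                  ∀ {F : Pattern} → W F → W (λ z → F (fromSwaps A z)))
  where

  N : ℕ
  N = suc (d + e)

  W-translate : ∀ (v : Word N) {F : Pattern} → W F → W (λ z → F (translation v z))
  W-translate v = W-precompose _ (λ _ → parity-const d _) (translation-involutive v)

  W-transvect : ∀ {d′} → d ≡ suc d′ → ∀ j {F : Pattern} → W F → W (λ z → F (transvection j z))
  W-transvect {d′} refl j = W-precompose (transvectionSwaps j) (transvection-parity j d′) (transvection-involutive j)

  W-sum : ∀ K (a : Word K → Bool) (P : Word K → Pattern) → (∀ y → W (P y)) →
          W (λ z → parity K (λ y → a y ∧ P y z))
  W-sum zero    a P h with a ε
  ... | true  = h ε
  ... | false = W-false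
  W-sum (suc K) a P h = W-xor (W-sum K (λ y → a (y ▸ false)) (λ y → P (y ▸ false)) (λ y → h (y ▸ false)))
                              (W-sum K (λ y → a (y ▸ true)) (λ y → P (y ▸ true)) (λ y → h (y ▸ true)))

  W-convolve : ∀ (c : Word N → Bool) {F : Pattern} → W F → W (λ z → parity N (λ y → c y ∧ F (translation y z)))
  W-convolve c {F} wF = W-sum N c (λ y z → F (translation y z)) (λ y → W-translate y wF)

  -- Convolving with c turns c + c(· + u) into δ₀ + δᵤ: the autocorrelation of c is δ₀.
  pair-from-difference : ∀ (c : Word N → Bool) (u : Word N) {G : Pattern} → parity N c ≡ true →
                         (∀ (x : Word N) → G x ≡ c x xor c (x +ʷ u)) → W G → W (pair (0ʷ {N}) u)
  pair-from-difference c u {G} c-odd G≗ wG = W-ext convolution (W-convolve c wG)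
    where
    convolution : ∀ (x : Word N) → parity N (λ y → c y ∧ G (translation y x)) ≡ pair 0ʷ u x
    convolution x = begin
      parity N (λ y → c y ∧ G (translation y x))
        ≡⟨ parity-cong N (λ y → cong (λ t → c y ∧ G t) (translation-+ʷ x y)) ⟩
      parity N (λ y → c y ∧ G (x +ʷ y))
        ≡⟨ parity-cong N (λ y → trans (cong (c y ∧_) (G≗ (x +ʷ y)))
                                      (∧-distribˡ-xor (c y) (c (x +ʷ y)) (c (x +ʷ y +ʷ u)))) ⟩
      parity N (λ y → (c y ∧ c (x +ʷ y)) xor (c y ∧ c ((x +ʷ y) +ʷ u)))
        ≡⟨ parity-xor N (λ y → c y ∧ c (x +ʷ y)) (λ y → c y ∧ c (x +ʷ y +ʷ u)) ⟩
      parity N (λ y → c y ∧ c (x +ʷ y)) xor parity N (λ y → c y ∧ c ((x +ʷ y) +ʷ u))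
        ≡⟨ cong (parity N (λ y → c y ∧ c (x +ʷ y)) xor_)
                (parity-cong N (λ y → cong (λ t → c y ∧ c t) (+ʷ-interchange x y u))) ⟩
      parity N (λ y → c y ∧ c (x +ʷ y)) xor parity N (λ y → c y ∧ c ((x +ʷ u) +ʷ y))
        ≡⟨ cong₂ _xor_ (parity-autocorrelation N c c-odd x) (parity-autocorrelation N c c-odd (x +ʷ u)) ⟩
      (x == 0ʷ {N}) xor ((x +ʷ u) == 0ʷ {N})
        ≡⟨ cong ((x == 0ʷ {N}) xor_) (trans (==-+ʷ x u 0ʷ) (cong (x ==_) (+ʷ-identityˡ u))) ⟩
      pair 0ʷ u x ∎

  -- Stated at every level M ≡ N, so that pairs of words of level j + suc m need no transport.
  PairsAlong : ℕ → Set
  PairsAlong i = ∀ {M} → M ≡ N → (x : Word M) → W (pair x (x +ʷ unit i M))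

  pairs-from-origin : ∀ i → W (pair (0ʷ {N}) (unit i N)) → PairsAlong i
  pairs-from-origin i w0 refl x = W-ext translate-pair (W-translate x w0)
    where
    translate-pair : ∀ (z : Word N) → pair 0ʷ (unit i N) (translation x z) ≡ pair x (x +ʷ unit i N) z
    translate-pair z rewrite translation-+ʷ z x =
      cong₂ _xor_ (trans (==-+ʷ z x 0ʷ) (cong (z ==_) (+ʷ-identityˡ x)))
                  (trans (==-+ʷ z x (unit i N)) (cong (z ==_) (+ʷ-comm (unit i N) x)))

  correction : ∀ j m → Pattern → Pattern
  correction j m F z = parity m (λ y → blockParity j F (y ▸ false) ∧ pair (spike j y false) (spike j y true) z)

  correction-blockParity : ∀ j m (F : Pattern) (y : Word m) b →
                           blockParity j (correction j m F) (y ▸ b) ≡ blockParity j F (y ▸ false)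
  correction-blockParity j m F y b = begin
    blockParity j (correction j m F) (y ▸ b)
      ≡⟨ blockParity-sum j m _ (λ y′ → pair (spike j y′ false) (spike j y′ true)) (y ▸ b) ⟩
    parity m (λ y′ → blockParity j F (y′ ▸ false) ∧ blockParity j (pair (spike j y′ false) (spike j y′ true)) (y ▸ b))
      ≡⟨ parity-cong m (λ y′ → cong (blockParity j F (y′ ▸ false) ∧_) (pair-blockParity y′)) ⟩
    parity m (λ y′ → blockParity j F (y′ ▸ false) ∧ (y′ == y))
      ≡⟨ parity-δ m (λ y′ → blockParity j F (y′ ▸ false)) y ⟩
    blockParity j F (y ▸ false) ∎
    where
    either-child : ∀ x b → (x ∧ (if b then false else not false)) xor (x ∧ (if b then true else not true)) ≡ x
    either-child x false =
      trans (cong (_xor (x ∧ false)) (∧-identityʳ x)) (trans (cong (x xor_) (∧-zeroʳ x)) (xor-identityʳ x))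
    either-child x true  = trans (cong (_xor (x ∧ true)) (∧-zeroʳ x)) (∧-identityʳ x)
    pair-blockParity : ∀ y′ → blockParity j (pair (spike j y′ false) (spike j y′ true)) (y ▸ b) ≡ y′ == y
    pair-blockParity y′ = begin
      blockParity j (pair (spike j y′ false) (spike j y′ true)) (y ▸ b)
        ≡⟨ blockParity-xor j _ _ (y ▸ b) ⟩
      blockParity j (λ z → z == spike j y′ false) (y ▸ b) xor blockParity j (λ z → z == spike j y′ true) (y ▸ b)
        ≡⟨ cong₂ _xor_ (blockParity-δ j 0ʷ (y′ ▸ false) (y ▸ b)) (blockParity-δ j 0ʷ (y′ ▸ true) (y ▸ b)) ⟩
      ((y ▸ b) == (y′ ▸ false)) xor ((y ▸ b) == (y′ ▸ true))
        ≡⟨ either-child (y == y′) b ⟩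
      y == y′
        ≡⟨ ==-sym y y′ ⟩
      y′ == y ∎

  blockParity-correction : ∀ j m (F : Pattern) → (∀ (y : Word m) → blockParity (suc j) F y ≡ false) →
                           ∀ (y : Word (suc m)) → blockParity j (λ z → F z xor correction j m F z) y ≡ false
  blockParity-correction j m F even (y ▸ b) = begin
    blockParity j (λ z → F z xor correction j m F z) (y ▸ b)
      ≡⟨ blockParity-xor j F (correction j m F) (y ▸ b) ⟩
    blockParity j F (y ▸ b) xor blockParity j (correction j m F) (y ▸ b)
      ≡⟨ cong₂ _xor_ (blockParity-children j F y (even y) b) (correction-blockParity j m F y b) ⟩
    blockParity j F (y ▸ false) xor blockParity j F (y ▸ false)
      ≡⟨ xor-same (blockParity j F (y ▸ false)) ⟩
    false ∎

  W-correction : ∀ j m (F : Pattern) → j + suc m ≡ N → PairsAlong m → W (correction j m F)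
  W-correction j m F eq pairs =
    W-sum m (λ y → blockParity j F (y ▸ false)) (λ y → pair (spike j y false) (spike j y true))
          (λ y → W-ext (spike-pair y) (pairs eq (spike j y false)))
    where
    spike-pair : ∀ y (x : Word N) → pair (spike j y false) (spike j y false +ʷ unit m (j + suc m)) x
                                  ≡ pair (spike j y false) (spike j y true) x
    spike-pair y x = cong (λ t → (x == spike j y false) xor (x == t)) (sym (spike-true j y))

  fill : ∀ j m → j + m ≡ N → (∀ i → m ≤ i → i < N → PairsAlong i) →
         (F : Pattern) → (∀ (y : Word m) → blockParity j F y ≡ false) → W F
  fill zero    m refl pairs F vanish = W-ext (λ x → sym (vanish x)) W-false
  fill (suc j) m eq   pairs F vanish =
    W-ext (λ x → xor-cancelʳ (F x) (correction j m F x))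
          (W-xor (fill j (suc m) eq′ (λ i m<i → pairs i (<⇒≤ m<i)) _ (blockParity-correction j m F vanish))
                 (W-correction j m F eq′ (pairs m ≤-refl (subst (m <_) eq (s≤s (m≤n+m m j))))))
    where
    eq′ : j + suc m ≡ N
    eq′ = trans (+-suc j m) eq

  pair-step : ∀ {d′} → d ≡ suc d′ → ∀ i → W (pair (0ʷ {N}) (unit i N)) → W (pair (0ʷ {N}) (unit (suc i) N))
  pair-step d≡ i wP = W-ext shifted (W-translate u (W-xor (W-transvect d≡ i wP) wP))
    where
    u u′ : Word N
    u  = unit i N
    u′ = unit (suc i) N
    ==-transvection : ∀ (y w : Word N) → transvection i y == w ≡ y == transvection i w
    ==-transvection = ==-fromSwaps (transvectionSwaps i) (transvectionSwaps-invariant i)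
    shifted : ∀ (x : Word N) →
              pair 0ʷ u (transvection i (translation u x)) xor pair 0ʷ u (translation u x) ≡ pair 0ʷ u′ x
    shifted x rewrite translation-+ʷ x u = begin
      ((transvection i y == 0ʷ {N}) xor (transvection i y == u)) xor ((y == 0ʷ {N}) xor (y == u))
        ≡⟨ cong₂ (λ a b → (a xor b) xor ((y == 0ʷ {N}) xor (y == u)))
                 (trans (==-transvection y 0ʷ) (cong (y ==_) (transvection-0ʷ i)))
                 (trans (==-transvection y u) (cong (y ==_) (transvection-unit i N))) ⟩
      ((y == 0ʷ {N}) xor (y == u +ʷ u′)) xor ((y == 0ʷ {N}) xor (y == u))
        ≡⟨ xor-interchange (y == 0ʷ {N}) _ _ _ ⟩
      ((y == 0ʷ {N}) xor (y == 0ʷ {N})) xor ((y == u +ʷ u′) xor (y == u))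
        ≡⟨ cong (_xor ((y == u +ʷ u′) xor (y == u))) (xor-same (y == 0ʷ {N})) ⟩
      (y == u +ʷ u′) xor (y == u)
        ≡⟨ cong₂ _xor_ (trans (==-+ʷ x u (u +ʷ u′)) (cong (x ==_) (trans (+ʷ-comm (u +ʷ u′) u) (+ʷ-cancelˡ u u′))))
                       (trans (==-+ʷ x u u) (cong (x ==_) (+ʷ-self u))) ⟩
      (x == u′) xor (x == 0ʷ {N})
        ≡⟨ xor-comm (x == u′) _ ⟩
      pair 0ʷ u′ x ∎
      where
      y : Word N
      y = x +ʷ u

  module _ (F₀ : Pattern) (W-F₀ : W F₀)
           (F₀-even : ∀ (p : Word e) → blockParity (suc d) F₀ p ≡ false)
           (F₀-odd : parity e (λ p → blockParity d F₀ (p ▸ false)) ≡ true) where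

    pair-at-suc-e : ∀ {d′} → d ≡ suc d′ → W (pair (0ʷ {N}) (unit (suc e) N))
    pair-at-suc-e d≡ = pair-from-difference B u parity-B difference (W-xor (W-transvect d≡ e W-F₀) W-F₀)
      where
      u : Word N
      u = unit (suc e) N
      B : Pattern
      B y = letter y e ∧ F₀ y
      blockParity-B : ∀ (p : Word e) b → blockParity d B (p ▸ b) ≡ b ∧ blockParity d F₀ (p ▸ b)
      blockParity-B p b = begin
        blockParity d B (p ▸ b)                                    ≡⟨ blockParity≡parity d B (p ▸ b) ⟩
        parity d (λ t → letter ((p ▸ b) ⊕ t) e ∧ F₀ ((p ▸ b) ⊕ t))
          ≡⟨ parity-cong d (λ t → cong (_∧ F₀ ((p ▸ b) ⊕ t)) (letter-⊕ (p ▸ b) t)) ⟩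
        parity d (λ t → b ∧ F₀ ((p ▸ b) ⊕ t))                     ≡⟨ parity-∧ˡ d b _ ⟩
        b ∧ parity d (λ t → F₀ ((p ▸ b) ⊕ t))                      ≡⟨ cong (b ∧_) (sym (blockParity≡parity d F₀ (p ▸ b))) ⟩
        b ∧ blockParity d F₀ (p ▸ b)                               ∎
      parity-B : parity N B ≡ true
      parity-B = begin
        parity N B                                                 ≡⟨ parity-blocks (suc d) e B ⟩
        parity e (blockParity (suc d) B)
          ≡⟨ parity-cong e (λ p → begin
               blockParity (suc d) B p                             ≡⟨ blockParity-suc d B p ⟩
               blockParity d B (p ▸ false) xor blockParity d B (p ▸ true)
                 ≡⟨ cong₂ _xor_ (blockParity-B p false) (blockParity-B p true) ⟩
               blockParity d F₀ (p ▸ true)                         ≡⟨ blockParity-children d F₀ p (F₀-even p) true ⟩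
               blockParity d F₀ (p ▸ false)                        ∎) ⟩
        parity e (λ p → blockParity d F₀ (p ▸ false))              ≡⟨ F₀-odd ⟩
        true                                                       ∎
      difference : ∀ (x : Word N) → F₀ (transvection e x) xor F₀ x ≡ B x xor B (x +ʷ u)
      difference x rewrite transvection-eval e x | letter-+ʷ x u e | letter-unit (suc e) N e (<⇒≢ (n<1+n e))
        with letter x e
      ... | true  = xor-comm (F₀ (x +ʷ u)) (F₀ x)
      ... | false = xor-same (F₀ x)

    pair-above : ∀ {d′} → d ≡ suc d′ → ∀ {i} → suc e ≤′ i → W (pair (0ʷ {N}) (unit i N))
    pair-above d≡ ≤′-refl       = pair-at-suc-e d≡
    pair-above d≡ (≤′-step e<i) = pair-step d≡ _ (pair-above d≡ e<i)

    pairs-above : ∀ i → e < i → i < N → PairsAlong i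
    pairs-above i e<i i<N = by-cases d refl
      where
      by-cases : ∀ d′ → d ≡ d′ → PairsAlong i
      by-cases zero     d≡0 = contradiction (≤-pred (subst (λ t → i < suc (t + e)) d≡0 i<N)) (<⇒≱ e<i)
      by-cases (suc d′) d≡  = pairs-from-origin i (pair-above d≡ (≤⇒≤′ e<i))

    pair-at-e : W (pair (0ʷ {N}) (unit e N))
    pair-at-e = pair-from-difference c (unit e N) parity-c correction-eval W-correction₀
      where
      h : Word e → Bool
      h p = blockParity d F₀ (p ▸ false)
      c : Word N → Bool
      c y = parity e (λ p → h p ∧ (y == spike d p false))
      N≡ : d + suc e ≡ N
      N≡ = +-suc d e
      W-correction₀ : W (correction d e F₀)
      W-correction₀ = W-ext (λ x → xor-cancelˡ (F₀ x) (correction d e F₀ x))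
        (W-xor W-F₀ (fill d (suc e) N≡ pairs-above _ (blockParity-correction d e F₀ F₀-even)))
      parity-c : parity N c ≡ true
      parity-c = begin
        parity N c
          ≡⟨ parity-swap N e (λ y p → h p ∧ (y == spike d p false)) ⟩
        parity e (λ p → parity N (λ y → h p ∧ (y == spike d p false)))
          ≡⟨ parity-cong e (λ p → trans (parity-∧ˡ N (h p) (λ y → y == spike d p false))
                                  (trans (cong (h p ∧_) (parity-==-cast N≡ (spike d p false))) (∧-identityʳ (h p)))) ⟩
        parity e h
          ≡⟨ F₀-odd ⟩
        true ∎
      correction-eval : ∀ (x : Word N) → correction d e F₀ x ≡ c x xor c (x +ʷ unit e N)
      correction-eval x = begin
        parity e (λ p → h p ∧ ((x == spike d p false) xor (x == spike d p true)))
          ≡⟨ parity-cong e (λ p → cong (λ t → h p ∧ ((x == spike d p false) xor t))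
                                       (trans (cong (x ==_) (spike-true d p)) (==-unit-cast N≡ e x (spike d p false)))) ⟩
        parity e (λ p → h p ∧ ((x == spike d p false) xor ((x +ʷ unit e N) == spike d p false)))
          ≡⟨ parity-cong e (λ p → ∧-distribˡ-xor (h p) _ _) ⟩
        parity e (λ p → (h p ∧ (x == spike d p false)) xor (h p ∧ ((x +ʷ unit e N) == spike d p false)))
          ≡⟨ parity-xor e _ _ ⟩
        c x xor c (x +ʷ unit e N) ∎

    pairs : ∀ i → e ≤ i → i < N → PairsAlong i
    pairs i e≤i i<N with m≤n⇒m<n∨m≡n e≤i
    ... | inj₁ e<i  = pairs-above i e<i i<N
    ... | inj₂ refl = pairs-from-origin e pair-at-e

    vanishing-blockParity⇒W : ∀ (F : Pattern) → (∀ (p : Word e) → blockParity (suc d) F p ≡ false) → W F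
    vanishing-blockParity⇒W = fill (suc d) e refl pairs

SwapsOn : ∀ N → Map → (Word N → Bool) → Set
SwapsOn N p P = ∀ (x : Word N) c → p (x ▸ c) ≡ p x ▸ (c xor P x)

swapsOn-aut : ∀ {N} {τ p : Map} → IsAutInf τ → τ ≈[ suc N ] p → SwapsOn N p (swaps τ)
swapsOn-aut {N} {τ} {p} aut τ≈p x c = begin
  p (x ▸ c)                  ≡⟨ sym (τ≈p ≤-refl (x ▸ c)) ⟩
  τ (x ▸ c)                  ≡⟨ aut-▸ aut x c ⟩
  τ x ▸ (c xor swaps τ x)    ≡⟨ cong (_▸ (c xor swaps τ x)) (τ≈p (n≤1+n N) x) ⟩
  p x ▸ (c xor swaps τ x)    ∎

swapsOn-∘ : ∀ {N} {p q : Map} {P Q : Word N → Bool} →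
            SwapsOn N p P → SwapsOn N q Q → SwapsOn N (p ∘M q) (λ x → Q x xor P (q x))
swapsOn-∘ {p = p} {q} {P} {Q} p-swaps q-swaps x c = begin
  p (q (x ▸ c))                             ≡⟨ cong p (q-swaps x c) ⟩
  p (q x ▸ (c xor Q x))                     ≡⟨ p-swaps (q x) (c xor Q x) ⟩
  p (q x) ▸ ((c xor Q x) xor P (q x))       ≡⟨ cong (p (q x) ▸_) (xor-assoc c (Q x) (P (q x))) ⟩
  p (q x) ▸ (c xor (Q x xor P (q x)))       ∎

≈-suc : ∀ {N} {p q : Map} {P Q : Word N → Bool} →
        p ≈[ N ] q → SwapsOn N p P → SwapsOn N q Q → (∀ x → P x ≡ Q x) → p ≈[ suc N ] q
≈-suc {N} p≈q p-swaps q-swaps P≗Q {m} m≤1+N w with m≤n⇒m<n∨m≡n m≤1+N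
... | inj₁ m≤N = p≈q (≤-pred m≤N) w
≈-suc {N} {p} {q} {P} {Q} p≈q p-swaps q-swaps P≗Q m≤1+N (x ▸ c) | inj₂ refl = begin
  p (x ▸ c)               ≡⟨ p-swaps x c ⟩
  p x ▸ (c xor P x)       ≡⟨ cong₂ (λ y b → y ▸ (c xor b)) (p≈q ≤-refl x) (P≗Q x) ⟩
  q x ▸ (c xor Q x)       ≡⟨ sym (q-swaps x c) ⟩
  q (x ▸ c)               ∎

odd-cousins-parity : ∀ ℓ n (σ : Map) {k} (x : Word k) → OddCousins ℓ n σ x →
                     parity (n ∸ ℓ) (λ s → negAboveB ℓ σ (x ⊕ s)) ≡ true
odd-cousins-parity ℓ n σ x cousins = begin
  parity (n ∸ ℓ) (λ s → negAboveB ℓ σ (x ⊕ s))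
    ≡⟨ sym (xorOver-allWords (n ∸ ℓ) _) ⟩
  xorOver (allWords (n ∸ ℓ)) (λ s → negAboveB ℓ σ (x ⊕ s))
    ≡⟨ sym (odd-count _ (allWords (n ∸ ℓ))) ⟩
  odd (count (λ s → negAboveB ℓ σ (x ⊕ s)) (allWords (n ∸ ℓ)))
    ≡⟨ isEven≡false⇒odd (count (λ s → negAboveB ℓ σ (x ⊕ s)) (allWords (n ∸ ℓ))) cousins ⟩
  true ∎

module SubgroupOfM (d e : ℕ) (G : Map → Set)
  (G-resp : ∀ (σ τ : Map) → σ ≈[ suc (suc (d + e)) ] τ → G σ → G τ)
  (G⊆M : ∀ (σ : Map) → G σ → InMℓn (suc (suc d)) (suc (suc (d + e))) σ)
  (G-id : G idMap)
  (G-∘ : ∀ (σ τ : Map) → G σ → G τ → G (σ ∘M τ))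
  (G-onto : ∀ (τ : Map) → InMℓn (suc (suc d)) (suc (d + e)) τ → Σ Map (λ σ → G σ × (σ ≈[ suc (d + e) ] τ)))
  (σₙ : Map) (σₙ∈G : G σₙ) (σₙ-trivial : σₙ ≈[ suc (d + e) ] idMap)
  (σₙ-odd : OddCousins (suc (suc d)) (suc (suc (d + e))) σₙ ε)
  where

  ℓ N n : ℕ
  ℓ = suc (suc d)
  N = suc (d + e)
  n = suc N

  swapsOf : ∀ {g : Map} → G g → Pattern
  swapsOf {g} g∈G = swaps (proj₁ (G⊆M g g∈G))

  G-swapsOn : ∀ {g : Map} (g∈G : G g) → SwapsOn N g (swapsOf g∈G)
  G-swapsOn {g} g∈G = let (_ , (aut , _) , τ≈g) = G⊆M g g∈G in swapsOn-aut aut τ≈g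

  G-parity : ∀ {g : Map} (g∈G : G g) {k} (y : Word k) → parity (suc d) (λ s → swapsOf g∈G (y ⊕ s)) ≡ false
  G-parity {g} g∈G = Mℓ-parity (suc d) (proj₁ (proj₂ (G⊆M g g∈G)))

  Realised : Pattern → Set
  Realised F = Σ Map λ g → G g × (g ≈[ N ] idMap) × SwapsOn N g F

  realised-ext : ∀ {F F′ : Pattern} → (∀ (x : Word N) → F x ≡ F′ x) → Realised F → Realised F′
  realised-ext F≗F′ (g , g∈G , g-trivial , g-swaps) =
    g , g∈G , g-trivial , λ x c → trans (g-swaps x c) (cong (λ b → g x ▸ (c xor b)) (F≗F′ x))

  realised-false : Realised (λ _ → false)
  realised-false = idMap , G-id , (λ _ _ → refl) , λ x c → cong (x ▸_) (sym (xor-identityʳ c))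

  realised-xor : ∀ {F F′ : Pattern} → Realised F → Realised F′ → Realised (λ z → F z xor F′ z)
  realised-xor {F} {F′} (g , g∈G , g-trivial , g-swaps) (g′ , g′∈G , g′-trivial , g′-swaps) =
    realised-ext {F = λ z → F′ z xor F (g′ z)} {F′ = λ z → F z xor F′ z} combined
      ( g ∘M g′ , G-∘ g g′ g∈G g′∈G
      , (λ le w → trans (cong g (g′-trivial le w)) (g-trivial le w))
      , swapsOn-∘ {p = g} {g′} g-swaps g′-swaps )
    where
    combined : ∀ (x : Word N) → F′ x xor F (g′ x) ≡ F x xor F′ x
    combined x = trans (cong (λ y → F′ x xor F y) (g′-trivial ≤-refl x)) (xor-comm (F′ x) (F x))

  -- Conjugating by a lift a ∈ G of the involution ρ moves the leaf pattern F
  -- to F ∘ ρ, up to the leaf pattern of a ∘ a, which is realised as well.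
  realised-conjugate : ∀ (ρ : Map) → (∀ {m} (w : Word m) → ρ (ρ w) ≡ w) → ∀ {a : Map} → G a → a ≈[ N ] ρ →
                       ∀ {F : Pattern} → Realised F → Realised (λ z → F (ρ z))
  realised-conjugate ρ ρ-involutive {a} a∈G a≈ρ {F} (g , g∈G , g-trivial , g-swaps) =
    realised-ext {F = λ z → ((S z xor F (a z)) xor S (g (a z))) xor (S z xor S (a z))} {F′ = λ z → F (ρ z)}
      conjugate
      (realised-xor {F = λ z → (S z xor F (a z)) xor S (g (a z))} {F′ = λ z → S z xor S (a z)} aga aa)
    where
    S : Pattern
    S = swapsOf a∈G
    a-swaps : SwapsOn N a S
    a-swaps = G-swapsOn a∈G
    aa-trivial : ∀ {m} → m ≤ N → (w : Word m) → a (a w) ≡ w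
    aa-trivial le w = trans (cong a (a≈ρ le w)) (trans (a≈ρ le (ρ w)) (ρ-involutive w))
    aa : Realised (λ z → S z xor S (a z))
    aa = a ∘M a , G-∘ a a a∈G a∈G , aa-trivial , swapsOn-∘ {p = a} {a} a-swaps a-swaps
    aga : Realised (λ z → (S z xor F (a z)) xor S (g (a z)))
    aga = a ∘M (g ∘M a) , G-∘ a (g ∘M a) a∈G (G-∘ g a g∈G a∈G)
        , (λ le w → trans (cong a (g-trivial le (a w))) (aa-trivial le w))
        , swapsOn-∘ {p = a} {g ∘M a} a-swaps (swapsOn-∘ {p = g} {a} g-swaps a-swaps)
    conjugate : ∀ (x : Word N) → ((S x xor F (a x)) xor S (g (a x))) xor (S x xor S (a x)) ≡ F (ρ x)
    conjugate x = begin
      ((S x xor F (a x)) xor S (g (a x))) xor (S x xor S (a x))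
        ≡⟨ cong (λ y → ((S x xor F (a x)) xor S y) xor (S x xor S (a x))) (g-trivial ≤-refl (a x)) ⟩
      ((S x xor F (a x)) xor S (a x)) xor (S x xor S (a x))
        ≡⟨ xor-cancel-outer (S x) (F (a x)) (S (a x)) ⟩
      F (a x)
        ≡⟨ cong F (a≈ρ ≤-refl x) ⟩
      F (ρ x) ∎

  realised-precompose : ∀ (A : Pattern) → (∀ {k} (y : Word k) → parity (suc d) (λ s → A (y ⊕ s)) ≡ false) →
                        (∀ {m} (w : Word m) → fromSwaps A (fromSwaps A w) ≡ w) →
                        ∀ {F : Pattern} → Realised F → Realised (λ z → F (fromSwaps A z))
  realised-precompose A A-even ρ-involutive {F} =
    let (a , a∈G , a≈ρ) = G-onto (fromSwaps A) (fromSwaps A , fromSwaps-Mℓ (suc d) A A-even , λ _ _ → refl)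
    in realised-conjugate (fromSwaps A) ρ-involutive a∈G a≈ρ {F}

  open Spanning d e Realised (λ {F} {F′} → realised-ext {F} {F′}) realised-false
                 (λ {F} {F′} → realised-xor {F} {F′})
                 (λ A A-even ρ-involutive {F} → realised-precompose A A-even ρ-involutive {F})
    using (vanishing-blockParity⇒W)

  F₀ : Pattern
  F₀ = swapsOf σₙ∈G

  F₀-even : ∀ (p : Word e) → blockParity (suc d) F₀ p ≡ false
  F₀-even p = trans (blockParity≡parity (suc d) F₀ p) (G-parity σₙ∈G p)

  negAbove≡blockParity : ∀ (p : Word e) → negAboveB ℓ σₙ p ≡ blockParity d F₀ (p ▸ false)
  negAbove≡blockParity p = begin
    isMinus (sgn (suc d) σₙ (p ▸ false)) ∧ isMinus (sgn (suc d) σₙ (p ▸ true))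
      ≡⟨ cong₂ _∧_ (cousin-sign false) (trans (cousin-sign true) (blockParity-children d F₀ p (F₀-even p) true)) ⟩
    blockParity d F₀ (p ▸ false) ∧ blockParity d F₀ (p ▸ false)
      ≡⟨ ∧-idem _ ⟩
    blockParity d F₀ (p ▸ false) ∎
    where
    cousin-sign : ∀ b → isMinus (sgn (suc d) σₙ (p ▸ b)) ≡ blockParity d F₀ (p ▸ b)
    cousin-sign b = let (_ , (aut , _) , τ≈σₙ) = G⊆M σₙ σₙ∈G in
      trans (sgn-aut aut σₙ d (p ▸ b) (λ s → sym (τ≈σₙ (s≤s (≤-reflexive (+-suc d e))) ((p ▸ b) ⊕ s))))
            (sym (blockParity≡parity d F₀ (p ▸ b)))

  F₀-odd : parity e (λ p → blockParity d F₀ (p ▸ false)) ≡ true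
  F₀-odd = begin
    parity e (λ p → blockParity d F₀ (p ▸ false))
      ≡⟨ parity-cong e (λ p → trans (sym (negAbove≡blockParity p)) (sym (ε⊕ (negAboveB ℓ σₙ) p))) ⟩
    parity e (λ s → negAboveB ℓ σₙ (ε ⊕ s))
      ≡⟨ subst (λ k → parity k (λ s → negAboveB ℓ σₙ (ε ⊕ s)) ≡ true) (m+n∸m≡n d e)
               (odd-cousins-parity ℓ n σₙ ε σₙ-odd) ⟩
    true ∎

  F₀-realised : Realised F₀
  F₀-realised = σₙ , σₙ∈G , σₙ-trivial , G-swapsOn σₙ∈G

  M-difference-realised : ∀ {g τ : Map} (g∈G : G g) → InMℓ ℓ τ → Realised (λ x → swapsOf g∈G x xor swaps τ x)
  M-difference-realised {g} {τ} g∈G τ∈M = vanishing-blockParity⇒W F₀ F₀-realised F₀-even F₀-odd D D-even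
    where
    D : Pattern
    D x = swapsOf g∈G x xor swaps τ x
    D-even : ∀ (p : Word e) → blockParity (suc d) D p ≡ false
    D-even p = begin
      blockParity (suc d) D p
        ≡⟨ blockParity≡parity (suc d) D p ⟩
      parity (suc d) (λ s → swapsOf g∈G (p ⊕ s) xor swaps τ (p ⊕ s))
        ≡⟨ parity-xor (suc d) (λ s → swapsOf g∈G (p ⊕ s)) (λ s → swaps τ (p ⊕ s)) ⟩
      parity (suc d) (λ s → swapsOf g∈G (p ⊕ s)) xor parity (suc d) (λ s → swaps τ (p ⊕ s))
        ≡⟨ cong₂ _xor_ (G-parity g∈G p) (Mℓ-parity (suc d) τ∈M p) ⟩
      false ∎

  -- σ agrees with some g ∈ G on T_N; on the last level it differs from g by the
  -- leaf pattern swaps g + swaps σ, realised in G since both lie in M_ℓ.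
  completion : ∀ {σ τ g : Map} (g∈G : G g) → g ≈[ N ] σ → IsAutInf τ → τ ≈[ n ] σ →
               Realised (λ x → swapsOf g∈G x xor swaps τ x) → G σ
  completion {σ} {τ} {g} g∈G g≈σ τ-aut τ≈σ (g′ , g′∈G , g′-trivial , g′-swaps) =
    G-resp (g ∘M g′) σ
      (≈-suc {p = g ∘M g′} {σ} {P = λ x → (Sg x xor swaps τ x) xor Sg (g′ x)} {Q = swaps τ}
             (λ le w → trans (cong g (g′-trivial le w)) (g≈σ le w))
             (swapsOn-∘ {p = g} {g′} (G-swapsOn g∈G) g′-swaps) (swapsOn-aut τ-aut τ≈σ) leaf)
      (G-∘ g g′ g∈G g′∈G)
    where
    Sg : Pattern
    Sg = swapsOf g∈G
    leaf : ∀ (x : Word N) → (Sg x xor swaps τ x) xor Sg (g′ x) ≡ swaps τ x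
    leaf x = begin
      (Sg x xor swaps τ x) xor Sg (g′ x) ≡⟨ cong (λ y → (Sg x xor swaps τ x) xor Sg y) (g′-trivial ≤-refl x) ⟩
      (Sg x xor swaps τ x) xor Sg x      ≡⟨ xor-comm (Sg x xor swaps τ x) (Sg x) ⟩
      Sg x xor (Sg x xor swaps τ x)      ≡⟨ xor-cancelˡ (Sg x) (swaps τ x) ⟩
      swaps τ x                          ∎

  G-complete : ∀ (σ : Map) → InMℓn ℓ n σ → G σ
  G-complete σ (τ , τ∈M , τ≈σ) =
    let (g , g∈G , g≈σ) = G-onto σ (τ , τ∈M , λ le → τ≈σ (m≤n⇒m≤1+n le))
    in completion g∈G g≈σ (proj₁ τ∈M) τ≈σ (M-difference-realised g∈G τ∈M)

theorem5p4 : (ℓ n : ℕ) → 2 ≤ ℓ → ℓ ≤ n → (G : Map → Set) →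
    -- G is a subgroup of M_{ℓ,n} (a set of maps on T_n)
    (∀ (σ τ : Map) → σ ≈[ n ] τ → G σ → G τ) →
    (∀ (σ : Map) → G σ → InMℓn ℓ n σ) →
    G idMap →
    (∀ (σ τ : Map) → G σ → G τ → G (σ ∘M τ)) →
    (∀ (σ : Map) → G σ → Σ Map (λ τ → G τ × ((τ ∘M σ) ≈[ n ] idMap) × ((σ ∘M τ) ≈[ n ] idMap))) →
    -- restriction of G to T_{n-1} is M_{ℓ,n-1}
    (∀ (σ : Map) → G σ → InMℓn ℓ (n ∸ 1) σ) →
    (∀ (τ : Map) → InMℓn ℓ (n ∸ 1) τ → Σ Map (λ σ → G σ × (σ ≈[ n ∸ 1 ] τ))) →
    -- σ_n ∈ G, trivial on T_{n-1}, (ℓ,n)-odd cousins map above the root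
    (σn : Map) → G σn → σn ≈[ n ∸ 1 ] idMap → OddCousins ℓ n σn ε →
    -- conclusion: G = M_{ℓ,n}
    (∀ (σ : Map) → InMℓn ℓ n σ → G σ)
theorem5p4 (suc (suc d)) (suc (suc m)) (s≤s (s≤s z≤n)) (s≤s (s≤s d≤m))
           G G-resp G⊆M G-id G-∘ _ _ G-onto σₙ σₙ∈G σₙ-trivial σₙ-odd
  with m≤n⇒∃[o]m+o≡n d≤m
... | e , refl = SubgroupOfM.G-complete d e G G-resp G⊆M G-id G-∘ G-onto σₙ σₙ∈G σₙ-trivial σₙ-odd
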